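{- Let $n\ge 1$. There is an involution $\Phi$ on the set $\mathcal{P}_n\setminus\mathcal{B}_n$ (that is, a map $\Phi:\mathcal{P}_n\setminus\mathcal{B}_n\to\mathcal{P}_n\setminus\mathcal{B}_n$ with $\Phi\circ\Phi=\mathrm{id}$) which is parity reversing: for every $T\in\mathcal{P}_n\setminus\mathcal{B}_n$, the number of leaves of $\Phi(T)$ and the number of leaves of $T$ have opposite parities.
   Context: A plane tree is a rooted tree in which the children of each vertex are linearly ordered (from left to right); the "first child" of a vertex is its leftmost child. A leaf is a non-root vertex with no children; an internal vertex is a vertex with at least one child. $\mathcal{P}_n$ denotes the set of (unlabelled) plane trees with $n$ edges. $\mathcal{B}_n\subseteq\mathcal{P}_n$ denotes the set of plane trees with $n$ edges such that every leaf is the first child of its parent and the first child of every internal vertex is a leaf. -}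

module Defs where

open import Data.Nat using (ℕ; zero; suc; _+_)
open import Data.List using (List; []; _∷_)
open import Data.Unit using (⊤)
open import Data.Empty using (⊥)
open import Data.Product using (_×_)

-- A plane tree: a root together with the ordered (left-to-right) list of
-- its subtrees.  The unlabelled plane trees are exactly the values of Tree.
data Tree : Set where
  node : List Tree → Tree

edges : Tree → ℕ
edgesF : List Tree → ℕ
edges (node ts) = edgesF ts
edgesF [] = 0
edgesF (t ∷ ts) = suc (edges t) + edgesF ts

-- number of leaves (non-root vertices with no children).
-- leavesF counts leaves among the vertices of a forest of subtrees hanging
-- from some vertex (so every root of the forest is a non-root vertex).
leavesF : List Tree → ℕ
leavesSub : Tree → ℕ
leavesSub (node []) = 1
leavesSub (node (t ∷ ts)) = leavesF (t ∷ ts)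
leavesF [] = 0
leavesF (t ∷ ts) = leavesSub t + leavesF ts

leaves : Tree → ℕ
leaves (node ts) = leavesF ts

IsLeaf : Tree → Set
IsLeaf (node []) = ⊤
IsLeaf (node (_ ∷ _)) = ⊥

IsInternal : Tree → Set
IsInternal (node []) = ⊥
IsInternal (node (_ ∷ _)) = ⊤

-- Membership in B: every leaf is the first child of its parent and the
-- first child of every internal vertex is a leaf.
InBF-rest : List Tree → Set
InB : Tree → Set
InB (node []) = ⊤
InB (node (c ∷ cs)) = IsLeaf c × InB c × InBF-rest cs
InBF-rest [] = ⊤
InBF-rest (c ∷ cs) = IsInternal c × InB c × InBF-rest cs

{-# OPTIONS --safe #-}
-- Φ acts at the first vertex, in preorder, whose children c₁ … cₖ violate the local
-- B-condition (c₁ a leaf, c₂ … cₖ internal).  If some cⱼ with j ≥ 2 is a leaf, the last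
-- such leaf adopts c₁ … cⱼ₋₁ (in reversed order) as its children, losing one leaf;
-- otherwise c₁ is internal and is replaced by its own children (in reversed order)
-- followed by a new leaf, gaining one leaf.  The two moves undo each other, preserve the
-- number of edges, and keep the local B-condition violated at that vertex and satisfied
-- at every earlier one, so Φ is an involution on 𝒫ₙ ∖ ℬₙ changing the number of leaves
-- by exactly one.
module Submission where

open import Defs
open import Data.Bool using (Bool; true; false; not; _∧_; if_then_else_; T)
open import Data.Bool.Properties using (∧-comm; ∧-isCommutativeMonoid; T-∧; T-≡; ¬-not)
open import Data.Bool.ListAction using (all)
open import Data.List using (List; []; _∷_; _∷ʳ_; map; reverse)
open import Data.List.Properties using (reverse-involutive; unfold-reverse)
open import Data.List.Relation.Binary.Permutation.Propositional using (_↭_; ↭⇒↭ₛ)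
open import Data.List.Relation.Binary.Permutation.Propositional.Properties using (map⁺; ↭-reverse)
open import Data.List.Relation.Binary.Permutation.Setoid.Properties using (foldr-commMonoid)
open import Data.Nat using (ℕ; zero; suc; _+_; _≥_; _%_)
open import Data.Nat.ListAction using (sum)
open import Data.Nat.ListAction.Properties using (sum-↭)
open import Data.Nat.Properties using (+-suc; +-comm; +-identityʳ)
open import Data.Product using (Σ; _×_; proj₁; ∃; _,_)
open import Data.Sum using (_⊎_; inj₁; inj₂)
open import Data.Unit using (tt)
open import Function using (_∘_; Equivalence)
open import Relation.Nullary using (¬_)
open import Relation.Binary.PropositionalEquality
  using (_≡_; _≢_; refl; sym; trans; cong; subst; subst₂; setoid; module ≡-Reasoning)

OneApart : ℕ → ℕ → Set
OneApart m n = suc m ≡ n ⊎ m ≡ suc n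

oneApart-+ˡ : ∀ k {m n} → OneApart m n → OneApart (k + m) (k + n)
oneApart-+ˡ k {m} (inj₁ p) = inj₁ (trans (sym (+-suc k m)) (cong (k +_) p))
oneApart-+ˡ k {n = n} (inj₂ p) = inj₂ (trans (cong (k +_) p) (+-suc k n))

oneApart-+ʳ : ∀ k {m n} → OneApart m n → OneApart (m + k) (n + k)
oneApart-+ʳ k {m} {n} p = subst₂ OneApart (+-comm k m) (+-comm k n) (oneApart-+ˡ k p)

suc-%2≢%2 : ∀ n → suc n % 2 ≢ n % 2
suc-%2≢%2 zero ()
suc-%2≢%2 (suc zero) ()
suc-%2≢%2 (suc (suc n)) = suc-%2≢%2 n

oneApart⇒%2≢ : ∀ {m n} → OneApart m n → m % 2 ≢ n % 2
oneApart⇒%2≢ {m} (inj₁ refl) = suc-%2≢%2 m ∘ sym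
oneApart⇒%2≢ {n = n} (inj₂ refl) = suc-%2≢%2 n

all-↭ : {A : Set} (p : A → Bool) {xs ys : List A} → xs ↭ ys → all p xs ≡ all p ys
all-↭ p xs↭ys = foldr-commMonoid (setoid Bool) ∧-isCommutativeMonoid (↭⇒↭ₛ (map⁺ p xs↭ys))

edgesF≡sum : (ts : List Tree) → edgesF ts ≡ sum (map (suc ∘ edges) ts)
edgesF≡sum [] = refl
edgesF≡sum (t ∷ ts) = cong (suc (edges t) +_) (edgesF≡sum ts)

leavesF≡sum : (ts : List Tree) → leavesF ts ≡ sum (map leavesSub ts)
leavesF≡sum [] = refl
leavesF≡sum (t ∷ ts) = cong (leavesSub t +_) (leavesF≡sum ts)

edgesF-↭ : {ts us : List Tree} → ts ↭ us → edgesF ts ≡ edgesF us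
edgesF-↭ {ts} {us} ts↭us = begin
  edgesF ts                     ≡⟨ edgesF≡sum ts ⟩
  sum (map (suc ∘ edges) ts)    ≡⟨ sum-↭ (map⁺ (suc ∘ edges) ts↭us) ⟩
  sum (map (suc ∘ edges) us)    ≡⟨ edgesF≡sum us ⟨
  edgesF us                     ∎
  where open ≡-Reasoning

leavesF-↭ : {ts us : List Tree} → ts ↭ us → leavesF ts ≡ leavesF us
leavesF-↭ {ts} {us} ts↭us = begin
  leavesF ts                ≡⟨ leavesF≡sum ts ⟩
  sum (map leavesSub ts)    ≡⟨ sum-↭ (map⁺ leavesSub ts↭us) ⟩
  sum (map leavesSub us)    ≡⟨ leavesF≡sum us ⟨
  leavesF us                ∎
  where open ≡-Reasoning

isLeaf : Tree → Bool
isLeaf (node []) = true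
isLeaf (node (_ ∷ _)) = false

isLeaf-cong-edges : ∀ t u → edges t ≡ edges u → isLeaf t ≡ isLeaf u
isLeaf-cong-edges (node []) (node []) _ = refl
isLeaf-cong-edges (node (_ ∷ _)) (node (_ ∷ _)) _ = refl

leavesSub≡leaves : ∀ t → isLeaf t ≡ false → leavesSub t ≡ leaves t
leavesSub≡leaves (node (_ ∷ _)) _ = refl

allInternal : List Tree → Bool
allInternal = all (not ∘ isLeaf)

rootInB : List Tree → Bool
rootInB [] = true
rootInB (c ∷ cs) = isLeaf c ∧ allInternal cs

inB : Tree → Bool
allInB : List Tree → Bool
inB (node cs) = rootInB cs ∧ allInB cs
allInB [] = true
allInB (t ∷ ts) = inB t ∧ allInB ts

inB≡false⇒isLeaf≡false : ∀ t → inB t ≡ false → isLeaf t ≡ false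
inB≡false⇒isLeaf≡false (node (_ ∷ _)) _ = refl

inB-sound : ∀ t → T (inB t) → InB t
InBF-rest-sound : ∀ cs → T (allInternal cs) → T (allInB cs) → InBF-rest cs
inB-sound (node []) _ = tt
inB-sound (node (node [] ∷ cs)) p =
  let (internal , inBs) = Equivalence.to T-∧ p in tt , tt , InBF-rest-sound cs internal inBs
InBF-rest-sound [] _ _ = tt
InBF-rest-sound (c@(node (_ ∷ _)) ∷ cs) internal p =
  let (inBc , inBs) = Equivalence.to T-∧ p in tt , inB-sound c inBc , InBF-rest-sound cs internal inBs

inB-complete : ∀ t → InB t → T (inB t)
InBF-rest-complete : ∀ cs → InBF-rest cs → T (allInternal cs) × T (allInB cs)
inB-complete (node []) _ = tt
inB-complete (node (node [] ∷ cs)) (_ , _ , rest) = Equivalence.from T-∧ (InBF-rest-complete cs rest)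
InBF-rest-complete [] _ = tt , tt
InBF-rest-complete (c@(node (_ ∷ _)) ∷ cs) (_ , inBc , rest) =
  let (internal , inBs) = InBF-rest-complete cs rest
  in internal , Equivalence.from T-∧ (inB-complete c inBc , inBs)

-- The local move acts on the reversed list of children, where the last leaf becomes the
-- first one and can be found by structural recursion.
toggleᴿ : List Tree → List Tree
toggleᴿ [] = []
toggleᴿ (node [] ∷ []) = node [] ∷ []
toggleᴿ (node [] ∷ c ∷ cs) = node (c ∷ cs) ∷ []
toggleᴿ (node (d ∷ ds) ∷ []) = node [] ∷ d ∷ ds
toggleᴿ (node (d ∷ ds) ∷ c ∷ cs) = node (d ∷ ds) ∷ toggleᴿ (c ∷ cs)

rootInBᴿ : List Tree → Bool
rootInBᴿ [] = true
rootInBᴿ (node [] ∷ []) = true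
rootInBᴿ (node [] ∷ _ ∷ _) = false
rootInBᴿ (node (_ ∷ _) ∷ []) = false
rootInBᴿ (node (_ ∷ _) ∷ c ∷ cs) = rootInBᴿ (c ∷ cs)

toggleᴿ-≢[] : ∀ c cs → toggleᴿ (c ∷ cs) ≢ []
toggleᴿ-≢[] (node []) [] ()
toggleᴿ-≢[] (node []) (_ ∷ _) ()
toggleᴿ-≢[] (node (_ ∷ _)) [] ()
toggleᴿ-≢[] (node (_ ∷ _)) (_ ∷ _) ()

toggleᴿ-skip : ∀ d ds cs → cs ≢ [] → toggleᴿ (node (d ∷ ds) ∷ cs) ≡ node (d ∷ ds) ∷ toggleᴿ cs
toggleᴿ-skip d ds [] cs≢[] with () ← cs≢[] refl
toggleᴿ-skip d ds (_ ∷ _) _ = refl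

rootInBᴿ-skip : ∀ d ds cs → cs ≢ [] → rootInBᴿ (node (d ∷ ds) ∷ cs) ≡ rootInBᴿ cs
rootInBᴿ-skip d ds [] cs≢[] with () ← cs≢[] refl
rootInBᴿ-skip d ds (_ ∷ _) _ = refl

toggleᴿ-involutive : ∀ cs → toggleᴿ (toggleᴿ cs) ≡ cs
toggleᴿ-involutive [] = refl
toggleᴿ-involutive (node [] ∷ []) = refl
toggleᴿ-involutive (node [] ∷ c ∷ cs) = refl
toggleᴿ-involutive (node (d ∷ ds) ∷ []) = refl
toggleᴿ-involutive (node (d ∷ ds) ∷ c ∷ cs) =
  trans (toggleᴿ-skip d ds (toggleᴿ (c ∷ cs)) (toggleᴿ-≢[] c cs))
        (cong (node (d ∷ ds) ∷_) (toggleᴿ-involutive (c ∷ cs)))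

rootInBᴿ-toggleᴿ : ∀ cs → rootInBᴿ (toggleᴿ cs) ≡ rootInBᴿ cs
rootInBᴿ-toggleᴿ [] = refl
rootInBᴿ-toggleᴿ (node [] ∷ []) = refl
rootInBᴿ-toggleᴿ (node [] ∷ c ∷ cs) = refl
rootInBᴿ-toggleᴿ (node (d ∷ ds) ∷ []) = refl
rootInBᴿ-toggleᴿ (node (d ∷ ds) ∷ c ∷ cs) =
  trans (rootInBᴿ-skip d ds (toggleᴿ (c ∷ cs)) (toggleᴿ-≢[] c cs)) (rootInBᴿ-toggleᴿ (c ∷ cs))

edgesF-toggleᴿ : ∀ cs → edgesF (toggleᴿ cs) ≡ edgesF cs
edgesF-toggleᴿ [] = refl
edgesF-toggleᴿ (node [] ∷ []) = refl
edgesF-toggleᴿ (node [] ∷ c ∷ cs) = cong suc (+-identityʳ _)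
edgesF-toggleᴿ (node (d ∷ ds) ∷ []) = sym (+-identityʳ _)
edgesF-toggleᴿ (node (d ∷ ds) ∷ c ∷ cs) = cong (suc (edgesF (d ∷ ds)) +_) (edgesF-toggleᴿ (c ∷ cs))

leavesF-toggleᴿ : ∀ cs → rootInBᴿ cs ≡ false → OneApart (leavesF (toggleᴿ cs)) (leavesF cs)
leavesF-toggleᴿ (node [] ∷ c ∷ cs) _ = inj₁ (cong suc (+-identityʳ _))
leavesF-toggleᴿ (node (d ∷ ds) ∷ []) _ = inj₂ (cong suc (sym (+-identityʳ _)))
leavesF-toggleᴿ (node (d ∷ ds) ∷ c ∷ cs) h = oneApart-+ˡ (leavesF (d ∷ ds)) (leavesF-toggleᴿ (c ∷ cs) h)

rootInBᴿ-∷ʳ : ∀ cs c → rootInBᴿ (cs ∷ʳ c) ≡ allInternal cs ∧ isLeaf c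
rootInBᴿ-∷ʳ [] (node []) = refl
rootInBᴿ-∷ʳ [] (node (_ ∷ _)) = refl
rootInBᴿ-∷ʳ (node [] ∷ []) c = refl
rootInBᴿ-∷ʳ (node [] ∷ _ ∷ _) c = refl
rootInBᴿ-∷ʳ (node (_ ∷ _) ∷ []) (node []) = refl
rootInBᴿ-∷ʳ (node (_ ∷ _) ∷ []) (node (_ ∷ _)) = refl
rootInBᴿ-∷ʳ (node (_ ∷ _) ∷ c′ ∷ cs) c = rootInBᴿ-∷ʳ (c′ ∷ cs) c

rootInBᴿ-reverse : ∀ cs → rootInBᴿ (reverse cs) ≡ rootInB cs
rootInBᴿ-reverse [] = refl
rootInBᴿ-reverse (c ∷ cs) = begin
  rootInBᴿ (reverse (c ∷ cs))               ≡⟨ cong rootInBᴿ (unfold-reverse c cs) ⟩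
  rootInBᴿ (reverse cs ∷ʳ c)                ≡⟨ rootInBᴿ-∷ʳ (reverse cs) c ⟩
  allInternal (reverse cs) ∧ isLeaf c       ≡⟨ cong (_∧ isLeaf c) (all-↭ (not ∘ isLeaf) (↭-reverse cs)) ⟩
  allInternal cs ∧ isLeaf c                 ≡⟨ ∧-comm (allInternal cs) (isLeaf c) ⟩
  isLeaf c ∧ allInternal cs                 ∎
  where open ≡-Reasoning

toggle : List Tree → List Tree
toggle = reverse ∘ toggleᴿ ∘ reverse

toggle-involutive : ∀ cs → toggle (toggle cs) ≡ cs
toggle-involutive cs = begin
  reverse (toggleᴿ (reverse (reverse (toggleᴿ (reverse cs)))))
    ≡⟨ cong (reverse ∘ toggleᴿ) (reverse-involutive (toggleᴿ (reverse cs))) ⟩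
  reverse (toggleᴿ (toggleᴿ (reverse cs)))  ≡⟨ cong reverse (toggleᴿ-involutive (reverse cs)) ⟩
  reverse (reverse cs)                      ≡⟨ reverse-involutive cs ⟩
  cs                                        ∎
  where open ≡-Reasoning

rootInB-toggle : ∀ cs → rootInB (toggle cs) ≡ rootInB cs
rootInB-toggle cs = begin
  rootInB (toggle cs)                       ≡⟨ rootInBᴿ-reverse (toggle cs) ⟨
  rootInBᴿ (reverse (toggle cs))            ≡⟨ cong rootInBᴿ (reverse-involutive (toggleᴿ (reverse cs))) ⟩
  rootInBᴿ (toggleᴿ (reverse cs))           ≡⟨ rootInBᴿ-toggleᴿ (reverse cs) ⟩
  rootInBᴿ (reverse cs)                     ≡⟨ rootInBᴿ-reverse cs ⟩
  rootInB cs                                ∎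
  where open ≡-Reasoning

edgesF-toggle : ∀ cs → edgesF (toggle cs) ≡ edgesF cs
edgesF-toggle cs = begin
  edgesF (reverse (toggleᴿ (reverse cs)))   ≡⟨ edgesF-↭ (↭-reverse (toggleᴿ (reverse cs))) ⟩
  edgesF (toggleᴿ (reverse cs))             ≡⟨ edgesF-toggleᴿ (reverse cs) ⟩
  edgesF (reverse cs)                       ≡⟨ edgesF-↭ (↭-reverse cs) ⟩
  edgesF cs                                 ∎
  where open ≡-Reasoning

leavesF-toggle : ∀ cs → rootInB cs ≡ false → OneApart (leavesF (toggle cs)) (leavesF cs)
leavesF-toggle cs h =
  subst₂ OneApart (sym (leavesF-↭ (↭-reverse (toggleᴿ (reverse cs))))) (leavesF-↭ (↭-reverse cs))
    (leavesF-toggleᴿ (reverse cs) (trans (rootInBᴿ-reverse cs) h))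

Φ : Tree → Tree
Φ-forest : List Tree → List Tree
Φ (node cs) = node (if rootInB cs then Φ-forest cs else toggle cs)
Φ-forest [] = []
Φ-forest (t ∷ ts) = if inB t then t ∷ Φ-forest ts else Φ t ∷ ts

edges-Φ : ∀ t → edges (Φ t) ≡ edges t
edgesF-Φ-forest : ∀ ts → edgesF (Φ-forest ts) ≡ edgesF ts
edges-Φ (node cs) with rootInB cs
... | true = edgesF-Φ-forest cs
... | false = edgesF-toggle cs
edgesF-Φ-forest [] = refl
edgesF-Φ-forest (t ∷ ts) with inB t
... | true = cong (suc (edges t) +_) (edgesF-Φ-forest ts)
... | false = cong (λ e → suc e + edgesF ts) (edges-Φ t)

isLeaf-Φ : ∀ t → isLeaf (Φ t) ≡ isLeaf t
isLeaf-Φ t = isLeaf-cong-edges (Φ t) t (edges-Φ t)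

allInternal-Φ-forest : ∀ ts → allInternal (Φ-forest ts) ≡ allInternal ts
allInternal-Φ-forest [] = refl
allInternal-Φ-forest (t ∷ ts) with inB t
... | true = cong (not (isLeaf t) ∧_) (allInternal-Φ-forest ts)
... | false = cong (λ b → not b ∧ allInternal ts) (isLeaf-Φ t)

rootInB-Φ-forest : ∀ ts → rootInB (Φ-forest ts) ≡ rootInB ts
rootInB-Φ-forest [] = refl
rootInB-Φ-forest (t ∷ ts) with inB t
... | true = cong (isLeaf t ∧_) (allInternal-Φ-forest ts)
... | false = cong (_∧ allInternal ts) (isLeaf-Φ t)

inB-Φ : ∀ t → inB (Φ t) ≡ inB t
allInB-Φ-forest : ∀ ts → allInB (Φ-forest ts) ≡ allInB ts
inB-Φ (node cs) with rootInB cs in root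
... | true rewrite rootInB-Φ-forest cs | root = allInB-Φ-forest cs
... | false rewrite rootInB-toggle cs | root = refl
allInB-Φ-forest [] = refl
allInB-Φ-forest (t ∷ ts) with inB t in here
... | true rewrite here = allInB-Φ-forest ts
... | false rewrite inB-Φ t | here = refl

Φ-involutive : ∀ t → Φ (Φ t) ≡ t
Φ-forest-involutive : ∀ ts → Φ-forest (Φ-forest ts) ≡ ts
Φ-involutive (node cs) with rootInB cs in root
... | true rewrite rootInB-Φ-forest cs | root = cong node (Φ-forest-involutive cs)
... | false rewrite rootInB-toggle cs | root = cong node (toggle-involutive cs)
Φ-forest-involutive [] = refl
Φ-forest-involutive (t ∷ ts) with inB t in here
... | true rewrite here = cong (t ∷_) (Φ-forest-involutive ts)
... | false rewrite inB-Φ t | here | Φ-involutive t = refl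

leaves-Φ : ∀ t → inB t ≡ false → OneApart (leaves (Φ t)) (leaves t)
leavesF-Φ-forest : ∀ ts → allInB ts ≡ false → OneApart (leavesF (Φ-forest ts)) (leavesF ts)
leaves-Φ (node cs) h with rootInB cs in root
... | true = leavesF-Φ-forest cs h
... | false = leavesF-toggle cs root
leavesF-Φ-forest (t ∷ ts) h with inB t in here
... | true = oneApart-+ˡ (leavesSub t) (leavesF-Φ-forest ts h)
... | false = subst₂ OneApart (cong (_+ leavesF ts) (sym (leavesSub≡leaves (Φ t) Φt-internal)))
                             (cong (_+ leavesF ts) (sym (leavesSub≡leaves t t-internal)))
                             (oneApart-+ʳ (leavesF ts) (leaves-Φ t here))
  where
  t-internal : isLeaf t ≡ false
  t-internal = inB≡false⇒isLeaf≡false t here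
  Φt-internal : isLeaf (Φ t) ≡ false
  Φt-internal = trans (isLeaf-Φ t) t-internal

¬InB⇒inB≡false : ∀ t → ¬ InB t → inB t ≡ false
¬InB⇒inB≡false t t∉B = ¬-not (t∉B ∘ inB-sound t ∘ Equivalence.from T-≡)

¬InB-Φ : ∀ t → ¬ InB t → ¬ InB (Φ t)
¬InB-Φ t t∉B Φt∈B = t∉B (inB-sound t (subst T (inB-Φ t) (inB-complete (Φ t) Φt∈B)))

P∖B : ℕ → Set
P∖B n = Σ Tree (λ T → edges T ≡ n × ¬ InB T)

Φ-P∖B : ∀ n → P∖B n → P∖B n
Φ-P∖B n (t , t-edges , t∉B) = Φ t , trans (edges-Φ t) t-edges , ¬InB-Φ t t∉B

theorem2 : (n : ℕ) → n ≥ 1 →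
    ∃ λ (Φ : Σ Tree (λ T → edges T ≡ n × ¬ InB T) → Σ Tree (λ T → edges T ≡ n × ¬ InB T)) →
      ((T : Σ Tree (λ T → edges T ≡ n × ¬ InB T)) → proj₁ (Φ (Φ T)) ≡ proj₁ T)
      × ((T : Σ Tree (λ T → edges T ≡ n × ¬ InB T)) → leaves (proj₁ (Φ T)) % 2 ≢ leaves (proj₁ T) % 2)
theorem2 n _ =
  Φ-P∖B n ,
  (λ (t , _) → Φ-involutive t) ,
  (λ (t , _ , t∉B) → oneApart⇒%2≢ (leaves-Φ t (¬InB⇒inB≡false t t∉B)))
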